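{- Let $n\ge 0$ and let $S,T\subseteq \mathbb{F}_2^n$ be complementary sets, i.e. $S\cap T=\emptyset$ and $S\cup T=\mathbb{F}_2^n$. Let $s$ be the number of quads contained in $S$ and $t$ the number of quads contained in $T$. Then \[ s-t=\frac{1}{4}\left[\binom{|S|}{3}-\binom{|T|}{3}\right]+\frac{1}{12}\left[|S|\binom{|T|}{2}-|T|\binom{|S|}{2}\right]=\frac{|S|-|T|}{24}\left(|S|^2+|T|^2-3|S|-3|T|+2\right). \]
   Context: An EvenQuads deck of size $2^n$ is the set $\mathbb{F}_2^n$; its elements are called cards. A quad is a $4$-element subset $\{a,b,c,d\}$ of the deck with $a+b+c+d=0$. The number of quads contained in a set of cards is the number of its $4$-element subsets that are quads. -}

module Defs where

open import Data.Bool using (Bool; true; false; _xor_; _∧_; not)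
open import Data.Nat using (ℕ; zero; suc)
open import Data.List using (List; []; _∷_; _++_; map; filter; length)
open import Data.Vec using (Vec; []; _∷_; replicate; zipWith)
import Data.Bool.Properties as BP

-- A card of the EvenQuads deck of size 2^n: an element of 𝔽₂ⁿ,
-- represented as a bit vector (Bool = 𝔽₂, addition = xor).
Card : ℕ → Set
Card n = Vec Bool n

_⊕_ : ∀ {n} → Card n → Card n → Card n
_⊕_ = zipWith _xor_

𝟘 : ∀ {n} → Card n
𝟘 = replicate _ false

deck : (n : ℕ) → List (Card n)
deck zero    = [] ∷ []
deck (suc n) = map (false ∷_) (deck n) ++ map (true ∷_) (deck n)

-- All k-element sublists of a list (order-preserving); applied to a
-- duplicate-free list, these are exactly its k-element subsets, each once.
choose : ∀ {A : Set} → ℕ → List A → List (List A)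
choose zero    _        = [] ∷ []
choose (suc k) []       = []
choose (suc k) (x ∷ xs) = map (x ∷_) (choose k xs) ++ choose (suc k) xs

sumCards : ∀ {n} → List (Card n) → Card n
sumCards []       = 𝟘
sumCards (x ∷ xs) = x ⊕ sumCards xs

isZero : ∀ {n} → Card n → Bool
isZero []          = true
isZero (b ∷ v)     = not b ∧ isZero v

allIn : ∀ {A : Set} → (A → Bool) → List A → Bool
allIn P []       = true
allIn P (x ∷ xs) = P x ∧ allIn P xs

CardSet : ℕ → Set
CardSet n = Card n → Bool

size : ∀ {n} → CardSet n → ℕ
size {n} S = length (filter (λ x → S x BP.≟ true) (deck n))

isQuad : ∀ {n} → List (Card n) → Bool
isQuad q = isZero (sumCards q)

quadCount : ∀ {n} → CardSet n → ℕ
quadCount {n} S =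
  length (filter (λ q → (allIn S q ∧ isQuad q) BP.≟ true) (choose 4 (deck n)))

open import Data.Rational using (ℚ)
import Data.Rational as ℚ
import Data.Integer as ℤ

ℕ→ℚ : ℕ → ℚ
ℕ→ℚ m = ℤ.+ m ℚ./ 1

module Submission where

-- Let χ, χ′ be the indicators of S and T, m = |S|, m′ = |T|, and let
-- U(f,g,h,k) = Σ_{a,b,c} f a · g b · h c · k (a+b+c) be the weighted count of ordered quads.
-- In U(χ,χ,χ,χ) the triples with a repeated card contribute m² + 2(m² − m), since a repeated
-- card forces the fourth card to be the remaining one, while the triples of distinct cards count
-- every quad of S once for each of its 4! orderings; hence U(χ,χ,χ,χ) + 2m = 3m² + 24s.
-- U is additive in each slot, and a slot that is constantly 1 leaves the other three cards free,
-- so there U is a product of sums. Replacing χ′ by χ = 1 − χ′ one slot at a time therefore gives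
-- U(χ′,χ′,χ′,χ′) − U(χ,χ,χ,χ) = m′³ − m m′² + m² m′ − m³, and eliminating both U's leaves
-- 24(s − t) = (m − m′)(m² + m′² − 3m − 3m′ + 2).

open import Defs
open import Data.Bool using (Bool; true; false; not; _∧_; _xor_)
import Data.Bool.Properties as Boolₚ
open import Data.Nat using (ℕ; zero; suc)
open import Data.List using (List; []; _∷_; _++_; map; filter; length)
open import Data.List.Relation.Unary.All as All using (All; []; _∷_)
open import Data.List.Relation.Unary.Unique.Propositional using (Unique)
open import Data.List.Membership.Propositional using (_∈_)
open import Data.List.Relation.Binary.Permutation.Propositional as ↭ using (_↭_)
open import Data.Product using (_×_; _,_; proj₁; proj₂)
open import Function using (_∘_)
open import Relation.Binary.Definitions using (DecidableEquality)
open import Relation.Binary.PropositionalEquality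
  using (_≡_; _≢_; refl; sym; trans; cong; cong₂; ≢-sym; module ≡-Reasoning)

module Sums where
  open import Data.Nat using (_+_; _*_)
  open import Data.Nat.Properties
    using (+-assoc; *-zeroʳ; *-distribˡ-+; *-distribʳ-+; +-commutativeSemigroup)
  open import Algebra.Properties.CommutativeSemigroup +-commutativeSemigroup using (interchange)
  open import Data.List.Relation.Unary.Any using (here; there)

  ∑ : ∀ {A : Set} → List A → (A → ℕ) → ℕ
  ∑ []       f = 0
  ∑ (x ∷ xs) f = f x + ∑ xs f

  syntax ∑ xs (λ x → e) = ∑[ x ∈ xs ] e

  module _ {A : Set} where

    ∑-cong : ∀ (xs : List A) {f g : A → ℕ} → (∀ x → f x ≡ g x) → ∑ xs f ≡ ∑ xs g
    ∑-cong []       f≗g = refl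
    ∑-cong (x ∷ xs) f≗g = cong₂ _+_ (f≗g x) (∑-cong xs f≗g)

    ∑-cong-∈ : ∀ (xs : List A) {f g : A → ℕ} → (∀ {x} → x ∈ xs → f x ≡ g x) → ∑ xs f ≡ ∑ xs g
    ∑-cong-∈ []       f≗g = refl
    ∑-cong-∈ (x ∷ xs) f≗g = cong₂ _+_ (f≗g (here refl)) (∑-cong-∈ xs (f≗g ∘ there))

    ∑-zero : ∀ (xs : List A) {f : A → ℕ} → (∀ x → f x ≡ 0) → ∑ xs f ≡ 0
    ∑-zero []       f≗0 = refl
    ∑-zero (x ∷ xs) f≗0 = cong₂ _+_ (f≗0 x) (∑-zero xs f≗0)

    ∑-+ : ∀ (xs : List A) (f g : A → ℕ) → ∑[ x ∈ xs ] (f x + g x) ≡ ∑ xs f + ∑ xs g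
    ∑-+ []       f g = refl
    ∑-+ (x ∷ xs) f g =
      trans (cong (f x + g x +_) (∑-+ xs f g)) (interchange (f x) (g x) (∑ xs f) (∑ xs g))

    ∑-*ˡ : ∀ (xs : List A) k (f : A → ℕ) → ∑[ x ∈ xs ] (k * f x) ≡ k * ∑ xs f
    ∑-*ˡ []       k f = sym (*-zeroʳ k)
    ∑-*ˡ (x ∷ xs) k f = trans (cong (k * f x +_) (∑-*ˡ xs k f)) (sym (*-distribˡ-+ k (f x) _))

    ∑-*ʳ : ∀ (xs : List A) k (f : A → ℕ) → ∑[ x ∈ xs ] (f x * k) ≡ ∑ xs f * k
    ∑-*ʳ []       k f = refl
    ∑-*ʳ (x ∷ xs) k f = trans (cong (f x * k +_) (∑-*ʳ xs k f)) (sym (*-distribʳ-+ k (f x) _))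

    ∑-++ : ∀ (xs ys : List A) (f : A → ℕ) → ∑ (xs ++ ys) f ≡ ∑ xs f + ∑ ys f
    ∑-++ []       ys f = refl
    ∑-++ (x ∷ xs) ys f = trans (cong (f x +_) (∑-++ xs ys f)) (sym (+-assoc (f x) _ _))

  module _ {A B : Set} where

    ∑-map : ∀ (g : A → B) (xs : List A) (f : B → ℕ) → ∑ (map g xs) f ≡ ∑[ x ∈ xs ] f (g x)
    ∑-map g []       f = refl
    ∑-map g (x ∷ xs) f = cong (f (g x) +_) (∑-map g xs f)

    ∑-comm : ∀ (xs : List A) (ys : List B) (f : A → B → ℕ) →
             ∑[ x ∈ xs ] ∑[ y ∈ ys ] f x y ≡ ∑[ y ∈ ys ] ∑[ x ∈ xs ] f x y
    ∑-comm []       ys f = sym (∑-zero ys (λ _ → refl))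
    ∑-comm (x ∷ xs) ys f =
      trans (cong (∑ ys (f x) +_) (∑-comm xs ys f)) (sym (∑-+ ys (f x) _))

  𝟙 : Bool → ℕ
  𝟙 true  = 1
  𝟙 false = 0

  length-filter≡∑𝟙 : ∀ {A : Set} (P : A → Bool) xs →
                     length (filter (λ x → P x Boolₚ.≟ true) xs) ≡ ∑[ x ∈ xs ] 𝟙 (P x)
  length-filter≡∑𝟙 P []       = refl
  length-filter≡∑𝟙 P (x ∷ xs) with P x
  ... | true  = cong suc (length-filter≡∑𝟙 P xs)
  ... | false = length-filter≡∑𝟙 P xs

module Arrangements {A : Set} (_≟_ : DecidableEquality A) where
  open import Data.Nat using (_+_; _*_; _!)
  open import Data.Nat.Properties
    using (+-assoc; +-identityʳ; *-assoc; *-zeroʳ; *-distribˡ-+; +-commutativeSemigroup)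
  open import Algebra.Properties.CommutativeSemigroup +-commutativeSemigroup using (x∙yz≈y∙xz)
  open import Data.List.Properties using (filter-all)
  import Data.List.Relation.Unary.All.Properties as Allₚ
  open import Data.List.Relation.Unary.AllPairs using (_∷_)
  open import Data.List.Relation.Unary.Any using (here; there)
  import Data.List.Relation.Unary.Unique.Propositional.Properties as Uniqueₚ
  open import Data.List.Membership.Propositional.Properties using (∈-filter⁺; ∈-filter⁻)
  open import Relation.Nullary using (¬?)
  open import Relation.Nullary.Decidable using (dec-true; dec-false)
  open Sums

  open ≡-Reasoning

  remove : A → List A → List A
  remove y = filter (λ x → ¬? (x ≟ y))

  ∈-remove⁻ : ∀ {x y xs} → x ∈ remove y xs → x ∈ xs × x ≢ y
  ∈-remove⁻ {y = y} = ∈-filter⁻ (λ x → ¬? (x ≟ y))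

  ∈-remove⁺ : ∀ {x y xs} → x ∈ xs → x ≢ y → x ∈ remove y xs
  ∈-remove⁺ {y = y} = ∈-filter⁺ (λ x → ¬? (x ≟ y))

  remove-unique : ∀ {xs} y → Unique xs → Unique (remove y xs)
  remove-unique y = Uniqueₚ.filter⁺ (λ x → ¬? (x ≟ y))

  remove-fresh : ∀ {x xs} → All (x ≢_) xs → remove x xs ≡ xs
  remove-fresh x∉xs = filter-all (λ z → ¬? (z ≟ _)) (All.map (λ x≢z → x≢z ∘ sym) x∉xs)

  remove-head : ∀ x xs → remove x (x ∷ xs) ≡ remove x xs
  remove-head x xs rewrite dec-true (x ≟ x) refl = refl

  remove-∷ : ∀ {x y} xs → x ≢ y → remove y (x ∷ xs) ≡ x ∷ remove y xs
  remove-∷ {x} {y} xs x≢y rewrite dec-false (x ≟ y) x≢y = refl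

  ∑-remove : ∀ {e xs} (g : A → ℕ) → Unique xs → e ∈ xs → ∑ xs g ≡ g e + ∑ (remove e xs) g
  ∑-remove {xs = x ∷ xs} g (x∉xs ∷ _) (here refl) =
    cong (g x +_) (cong (λ ys → ∑ ys g) (sym (trans (remove-head x xs) (remove-fresh x∉xs))))
  ∑-remove {e} {x ∷ xs} g (x∉xs ∷ u) (there e∈xs) = begin
    g x + ∑ xs g                             ≡⟨ cong (g x +_) (∑-remove g u e∈xs) ⟩
    g x + (g e + ∑ (remove e xs) g)          ≡⟨ x∙yz≈y∙xz (g x) (g e) _ ⟩
    g e + (g x + ∑ (remove e xs) g)          ≡⟨ cong (λ ys → g e + ∑ ys g) (sym (remove-∷ xs x≢e)) ⟩
    g e + ∑ (remove e (x ∷ xs)) g            ∎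
    where x≢e = All.lookup x∉xs e∈xs

  ∑-point : ∀ {e xs} (g : A → ℕ) → Unique xs → e ∈ xs →
            (∀ {d} → d ≢ e → g d ≡ 0) → ∑ xs g ≡ g e
  ∑-point {e} {xs} g u e∈xs g≡0 = begin
    ∑ xs g                      ≡⟨ ∑-remove g u e∈xs ⟩
    g e + ∑ (remove e xs) g
      ≡⟨ cong (g e +_) (∑-cong-∈ (remove e xs) (g≡0 ∘ proj₂ ∘ ∈-remove⁻ {xs = xs})) ⟩
    g e + ∑[ _ ∈ remove e xs ] 0 ≡⟨ cong (g e +_) (∑-zero (remove e xs) (λ _ → refl)) ⟩
    g e + 0                     ≡⟨ +-identityʳ (g e) ⟩
    g e                         ∎

  PermutationInvariant : (List A → ℕ) → Set
  PermutationInvariant H = ∀ {p q} → p ↭ q → H p ≡ H q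

  arrangementSum : ℕ → List A → (List A → ℕ) → ℕ
  arrangementSum zero    xs H = H []
  arrangementSum (suc k) xs H = ∑[ y ∈ xs ] arrangementSum k (remove y xs) (H ∘ (y ∷_))

  arrangementSum-cong : ∀ k xs {H H′ : List A → ℕ} → (∀ q → H q ≡ H′ q) →
                        arrangementSum k xs H ≡ arrangementSum k xs H′
  arrangementSum-cong zero    xs H≗H′ = H≗H′ []
  arrangementSum-cong (suc k) xs H≗H′ =
    ∑-cong xs (λ y → arrangementSum-cong k (remove y xs) (H≗H′ ∘ (y ∷_)))

  arrangementSum-∷ : ∀ k {x xs} H → PermutationInvariant H → All (x ≢_) xs →
    arrangementSum (suc k) (x ∷ xs) H
      ≡ suc k * arrangementSum k xs (H ∘ (x ∷_)) + arrangementSum (suc k) xs H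
  arrangementSum-∷ k {x} {xs} H inv x∉xs = begin
    arrangementSum k (remove x (x ∷ xs)) (H ∘ (x ∷_))
      + ∑[ y ∈ xs ] arrangementSum k (remove y (x ∷ xs)) (H ∘ (y ∷_))
      ≡⟨ cong₂ _+_ (cong (λ ys → arrangementSum k ys (H ∘ (x ∷_)))
                         (trans (remove-head x xs) (remove-fresh x∉xs)))
                   (∑-cong-∈ xs (λ y∈xs → cong (λ ys → arrangementSum k ys _)
                                             (remove-∷ xs (All.lookup x∉xs y∈xs)))) ⟩
    arrangementSum k xs (H ∘ (x ∷_)) + ∑[ y ∈ xs ] arrangementSum k (x ∷ remove y xs) (H ∘ (y ∷_))
      ≡⟨ cong (arrangementSum k xs (H ∘ (x ∷_)) +_) (others k) ⟩
    arrangementSum k xs (H ∘ (x ∷_))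
      + (k * arrangementSum k xs (H ∘ (x ∷_)) + arrangementSum (suc k) xs H)
      ≡⟨ sym (+-assoc (arrangementSum k xs (H ∘ (x ∷_))) _ _) ⟩
    suc k * arrangementSum k xs (H ∘ (x ∷_)) + arrangementSum (suc k) xs H ∎
    where
    others : ∀ k → ∑[ y ∈ xs ] arrangementSum k (x ∷ remove y xs) (H ∘ (y ∷_))
                   ≡ k * arrangementSum k xs (H ∘ (x ∷_)) + arrangementSum (suc k) xs H
    others zero    = refl
    others (suc k) = begin
      ∑[ y ∈ xs ] arrangementSum (suc k) (x ∷ remove y xs) (H ∘ (y ∷_))
        ≡⟨ ∑-cong xs (λ y → arrangementSum-∷ k (H ∘ (y ∷_)) (inv ∘ ↭.prep y)
                                (Allₚ.filter⁺ _ x∉xs)) ⟩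
      ∑[ y ∈ xs ] (suc k * arrangementSum k (remove y xs) (λ q → H (y ∷ x ∷ q))
                   + arrangementSum (suc k) (remove y xs) (H ∘ (y ∷_)))
        ≡⟨ ∑-+ xs _ _ ⟩
      ∑[ y ∈ xs ] (suc k * arrangementSum k (remove y xs) (λ q → H (y ∷ x ∷ q)))
        + arrangementSum (suc (suc k)) xs H
        ≡⟨ cong (_+ _) (∑-*ˡ xs (suc k) _) ⟩
      suc k * ∑[ y ∈ xs ] arrangementSum k (remove y xs) (λ q → H (y ∷ x ∷ q))
        + arrangementSum (suc (suc k)) xs H
        ≡⟨ cong (λ s → suc k * s + _) (∑-cong xs (λ y →
             arrangementSum-cong k (remove y xs) (λ q → inv (↭.swap y x ↭.refl)))) ⟩
      suc k * arrangementSum (suc k) xs (H ∘ (x ∷_)) + arrangementSum (suc (suc k)) xs H ∎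

  ∑-choose-∷ : ∀ k x xs (H : List A → ℕ) →
    ∑ (choose (suc k) (x ∷ xs)) H ≡ ∑ (choose k xs) (H ∘ (x ∷_)) + ∑ (choose (suc k) xs) H
  ∑-choose-∷ k x xs H =
    trans (∑-++ (map (x ∷_) (choose k xs)) _ H) (cong (_+ _) (∑-map (x ∷_) (choose k xs) H))

  arrangementSum≡k!*∑choose : ∀ k {xs} H → PermutationInvariant H → Unique xs →
                              arrangementSum k xs H ≡ k ! * ∑ (choose k xs) H
  arrangementSum≡k!*∑choose zero    H inv u = sym (trans (+-identityʳ _) (+-identityʳ (H [])))
  arrangementSum≡k!*∑choose (suc k) {[]} H inv u = sym (*-zeroʳ (suc k !))
  arrangementSum≡k!*∑choose (suc k) {x ∷ xs} H inv (x∉xs ∷ u) = begin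
    arrangementSum (suc k) (x ∷ xs) H
      ≡⟨ arrangementSum-∷ k H inv x∉xs ⟩
    suc k * arrangementSum k xs (H ∘ (x ∷_)) + arrangementSum (suc k) xs H
      ≡⟨ cong₂ _+_ (cong (suc k *_) (arrangementSum≡k!*∑choose k (H ∘ (x ∷_)) (inv ∘ ↭.prep x) u))
                   (arrangementSum≡k!*∑choose (suc k) H inv u) ⟩
    suc k * (k ! * ∑ (choose k xs) (H ∘ (x ∷_))) + suc k ! * ∑ (choose (suc k) xs) H
      ≡⟨ cong (_+ suc k ! * ∑ (choose (suc k) xs) H) (sym (*-assoc (suc k) (k !) _)) ⟩
    suc k ! * ∑ (choose k xs) (H ∘ (x ∷_)) + suc k ! * ∑ (choose (suc k) xs) H
      ≡⟨ sym (*-distribˡ-+ (suc k !) _ _) ⟩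
    suc k ! * (∑ (choose k xs) (H ∘ (x ∷_)) + ∑ (choose (suc k) xs) H)
      ≡⟨ cong (suc k ! *_) (sym (∑-choose-∷ k x xs H)) ⟩
    suc k ! * ∑ (choose (suc k) (x ∷ xs)) H ∎

module Cards where
  open import Data.Nat using (_+_)
  open import Data.Nat.Properties using (+-comm)
  open import Data.Vec using ([]; _∷_)
  open import Data.Vec.Properties
    using (≡-dec; ∷-injectiveʳ; zipWith-assoc; zipWith-comm; zipWith-identityˡ; zipWith-identityʳ)
  open import Data.List.Relation.Unary.AllPairs using ([]; _∷_)
  open import Data.List.Relation.Unary.Any using (here)
  import Data.List.Relation.Unary.Unique.Propositional.Properties as Uniqueₚ
  open import Data.List.Membership.Propositional.Properties using (∈-map⁺; ∈-map⁻; ∈-++⁺ˡ; ∈-++⁺ʳ)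
  open import Relation.Nullary using (¬_)
  open Sums

  ⊕-self : ∀ {n} (x : Card n) → x ⊕ x ≡ 𝟘
  ⊕-self []      = refl
  ⊕-self (b ∷ x) = cong₂ _∷_ (Boolₚ.xor-same b) (⊕-self x)

  module _ {n : ℕ} where
    open ≡-Reasoning

    _≟ᶜ_ : DecidableEquality (Card n)
    _≟ᶜ_ = ≡-dec Boolₚ._≟_

    ⊕-assoc : ∀ (x y z : Card n) → (x ⊕ y) ⊕ z ≡ x ⊕ (y ⊕ z)
    ⊕-assoc = zipWith-assoc Boolₚ.xor-assoc

    ⊕-comm : ∀ (x y : Card n) → x ⊕ y ≡ y ⊕ x
    ⊕-comm = zipWith-comm Boolₚ.xor-comm

    ⊕-identityˡ : ∀ (x : Card n) → 𝟘 ⊕ x ≡ x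
    ⊕-identityˡ = zipWith-identityˡ Boolₚ.xor-identityˡ

    ⊕-identityʳ : ∀ (x : Card n) → x ⊕ 𝟘 ≡ x
    ⊕-identityʳ = zipWith-identityʳ Boolₚ.xor-identityʳ

    x⊕[x⊕y]≡y : ∀ (x y : Card n) → x ⊕ (x ⊕ y) ≡ y
    x⊕[x⊕y]≡y x y = begin
      x ⊕ (x ⊕ y) ≡⟨ sym (⊕-assoc x x y) ⟩
      (x ⊕ x) ⊕ y ≡⟨ cong (_⊕ y) (⊕-self x) ⟩
      𝟘 ⊕ y       ≡⟨ ⊕-identityˡ y ⟩
      y           ∎

    x⊕[y⊕z]≡y⊕[x⊕z] : ∀ (x y z : Card n) → x ⊕ (y ⊕ z) ≡ y ⊕ (x ⊕ z)
    x⊕[y⊕z]≡y⊕[x⊕z] x y z = begin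
      x ⊕ (y ⊕ z) ≡⟨ sym (⊕-assoc x y z) ⟩
      (x ⊕ y) ⊕ z ≡⟨ cong (_⊕ z) (⊕-comm x y) ⟩
      (y ⊕ x) ⊕ z ≡⟨ ⊕-assoc y x z ⟩
      y ⊕ (x ⊕ z) ∎

    ⊕-cancelˡ : ∀ x {y z : Card n} → x ⊕ y ≡ x ⊕ z → y ≡ z
    ⊕-cancelˡ x {y} {z} eq = begin
      y           ≡⟨ sym (x⊕[x⊕y]≡y x y) ⟩
      x ⊕ (x ⊕ y) ≡⟨ cong (x ⊕_) eq ⟩
      x ⊕ (x ⊕ z) ≡⟨ x⊕[x⊕y]≡y x z ⟩
      z           ∎

    x⊕y≡𝟘⇒x≡y : ∀ {x y : Card n} → x ⊕ y ≡ 𝟘 → x ≡ y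
    x⊕y≡𝟘⇒x≡y {x} eq = sym (⊕-cancelˡ x (trans eq (sym (⊕-self x))))

    x⊕[y⊕z]≡x⇒y≡z : ∀ {x y z : Card n} → x ⊕ (y ⊕ z) ≡ x → y ≡ z
    x⊕[y⊕z]≡x⇒y≡z {x} eq = x⊕y≡𝟘⇒x≡y (⊕-cancelˡ x (trans eq (sym (⊕-identityʳ x))))

  isZero⇒≡𝟘 : ∀ {n} {x : Card n} → isZero x ≡ true → x ≡ 𝟘
  isZero⇒≡𝟘 {x = []}        _  = refl
  isZero⇒≡𝟘 {x = false ∷ x} eq = cong (false ∷_) (isZero⇒≡𝟘 eq)

  isZero-𝟘 : ∀ n → isZero (𝟘 {n}) ≡ true
  isZero-𝟘 zero    = refl
  isZero-𝟘 (suc n) = isZero-𝟘 n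

  fourth : ∀ {n} → Card n → Card n → Card n → Card n
  fourth a b c = a ⊕ (b ⊕ c)

  module _ {n : ℕ} (a b : Card n) where

    fourth-aab : fourth a a b ≡ b
    fourth-aab = x⊕[x⊕y]≡y a b

    fourth-aba : fourth a b a ≡ b
    fourth-aba = trans (x⊕[y⊕z]≡y⊕[x⊕z] a b a) (trans (cong (b ⊕_) (⊕-self a)) (⊕-identityʳ b))

    fourth-abb : fourth a b b ≡ a
    fourth-abb = trans (cong (a ⊕_) (⊕-self b)) (⊕-identityʳ a)

  module _ {n : ℕ} {a b c : Card n} where

    fourth≢₁ : b ≢ c → fourth a b c ≢ a
    fourth≢₁ b≢c = b≢c ∘ x⊕[y⊕z]≡x⇒y≡z

    fourth≢₂ : a ≢ c → fourth a b c ≢ b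
    fourth≢₂ a≢c = a≢c ∘ x⊕[y⊕z]≡x⇒y≡z ∘ trans (sym (x⊕[y⊕z]≡y⊕[x⊕z] a b c))

    fourth≢₃ : a ≢ b → fourth a b c ≢ c
    fourth≢₃ a≢b = a≢b ∘ x⊕[y⊕z]≡x⇒y≡z ∘ trans (sym (x⊕[y⊕z]≡y⊕[x⊕z] a c b))
                                        ∘ trans (cong (a ⊕_) (⊕-comm c b))

  module _ {n : ℕ} (a b c : Card n) where
    open ≡-Reasoning

    sumCards-quad : ∀ d → sumCards (a ∷ b ∷ c ∷ d ∷ []) ≡ fourth a b c ⊕ d
    sumCards-quad d = begin
      a ⊕ (b ⊕ (c ⊕ (d ⊕ 𝟘))) ≡⟨ cong (λ x → a ⊕ (b ⊕ (c ⊕ x))) (⊕-identityʳ d) ⟩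
      a ⊕ (b ⊕ (c ⊕ d))       ≡⟨ cong (a ⊕_) (sym (⊕-assoc b c d)) ⟩
      a ⊕ ((b ⊕ c) ⊕ d)       ≡⟨ sym (⊕-assoc a (b ⊕ c) d) ⟩
      fourth a b c ⊕ d        ∎

    isQuad⇒≡fourth : ∀ {d} → isQuad (a ∷ b ∷ c ∷ d ∷ []) ≡ true → d ≡ fourth a b c
    isQuad⇒≡fourth {d} q = sym (x⊕y≡𝟘⇒x≡y (trans (sym (sumCards-quad d)) (isZero⇒≡𝟘 q)))

    isQuad-fourth : isQuad (a ∷ b ∷ c ∷ fourth a b c ∷ []) ≡ true
    isQuad-fourth rewrite sumCards-quad (fourth a b c) | ⊕-self (fourth a b c) = isZero-𝟘 n

  deck-unique : ∀ n → Unique (deck n)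
  deck-unique zero    = [] ∷ []
  deck-unique (suc n) = Uniqueₚ.++⁺ (Uniqueₚ.map⁺ ∷-injectiveʳ (deck-unique n))
                                    (Uniqueₚ.map⁺ ∷-injectiveʳ (deck-unique n))
                                    false∷≢true∷
    where
    false∷≢true∷ : ∀ {v} → ¬ (v ∈ map (false ∷_) (deck n) × v ∈ map (true ∷_) (deck n))
    false∷≢true∷ (v∈₁ , v∈₂) with ∈-map⁻ (false ∷_) v∈₁ | ∈-map⁻ (true ∷_) v∈₂
    ... | _ , _ , refl | _ , _ , ()

  ∈-deck : ∀ {n} (x : Card n) → x ∈ deck n
  ∈-deck []          = here refl
  ∈-deck (false ∷ x) = ∈-++⁺ˡ (∈-map⁺ (false ∷_) (∈-deck x))
  ∈-deck (true ∷ x)  = ∈-++⁺ʳ (map (false ∷_) (deck _)) (∈-map⁺ (true ∷_) (∈-deck x))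

  ∑-deck-suc : ∀ n (g : Card (suc n) → ℕ) →
    ∑ (deck (suc n)) g ≡ ∑[ x ∈ deck n ] g (false ∷ x) + ∑[ x ∈ deck n ] g (true ∷ x)
  ∑-deck-suc n g = trans (∑-++ (map (false ∷_) (deck n)) _ g)
                           (cong₂ _+_ (∑-map (false ∷_) (deck n) g) (∑-map (true ∷_) (deck n) g))

  ∑-deck-translate : ∀ n (v : Card n) (f : Card n → ℕ) → ∑[ x ∈ deck n ] f (v ⊕ x) ≡ ∑ (deck n) f
  ∑-deck-translate zero    []      f = refl
  ∑-deck-translate (suc n) (b ∷ v) f = begin
    ∑[ x ∈ deck (suc n) ] f ((b ∷ v) ⊕ x)
      ≡⟨ ∑-deck-suc n _ ⟩
    ∑[ x ∈ deck n ] f ((b xor false) ∷ v ⊕ x) + ∑[ x ∈ deck n ] f ((b xor true) ∷ v ⊕ x)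
      ≡⟨ cong₂ _+_ (∑-deck-translate n v (f ∘ ((b xor false) ∷_)))
                   (∑-deck-translate n v (f ∘ ((b xor true) ∷_))) ⟩
    ∑[ x ∈ deck n ] f ((b xor false) ∷ x) + ∑[ x ∈ deck n ] f ((b xor true) ∷ x)
      ≡⟨ halves b ⟩
    ∑[ x ∈ deck n ] f (false ∷ x) + ∑[ x ∈ deck n ] f (true ∷ x)
      ≡⟨ sym (∑-deck-suc n f) ⟩
    ∑ (deck (suc n)) f ∎
    where
    open ≡-Reasoning
    halves : ∀ b → ∑[ x ∈ deck n ] f ((b xor false) ∷ x) + ∑[ x ∈ deck n ] f ((b xor true) ∷ x)
                 ≡ ∑[ x ∈ deck n ] f (false ∷ x) + ∑[ x ∈ deck n ] f (true ∷ x)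
    halves false = refl
    halves true  = +-comm (∑[ x ∈ deck n ] f (true ∷ x)) _

  sumCards-↭ : ∀ {n} {p q : List (Card n)} → p ↭ q → sumCards p ≡ sumCards q
  sumCards-↭ ↭.refl          = refl
  sumCards-↭ (↭.prep x p↭q)  = cong (x ⊕_) (sumCards-↭ p↭q)
  sumCards-↭ (↭.swap x y p↭q) =
    trans (x⊕[y⊕z]≡y⊕[x⊕z] x y _) (cong (λ z → y ⊕ (x ⊕ z)) (sumCards-↭ p↭q))
  sumCards-↭ (↭.trans p↭q q↭r) = trans (sumCards-↭ p↭q) (sumCards-↭ q↭r)

  allIn-↭ : ∀ {A : Set} (P : A → Bool) {p q : List A} → p ↭ q → allIn P p ≡ allIn P q
  allIn-↭ P ↭.refl            = refl
  allIn-↭ P (↭.prep x p↭q)    = cong (P x ∧_) (allIn-↭ P p↭q)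
  allIn-↭ P (↭.swap x y p↭q)  =
    trans (∧-leftComm (P x) (P y) _) (cong (λ b → P y ∧ (P x ∧ b)) (allIn-↭ P p↭q))
    where
    ∧-leftComm : ∀ p q r → p ∧ (q ∧ r) ≡ q ∧ (p ∧ r)
    ∧-leftComm false q r = sym (Boolₚ.∧-zeroʳ q)
    ∧-leftComm true  q r = refl
  allIn-↭ P (↭.trans p↭q q↭r) = trans (allIn-↭ P p↭q) (allIn-↭ P q↭r)

module QuadSums where
  open import Data.Nat using (_+_; _*_)
  open import Data.Nat.Properties using (+-comm; *-identityˡ; *-identityʳ; *-distribˡ-+)
  open import Data.Nat.Tactic.RingSolver using (solve-∀)
  open Sums
  open Cards

  module _ {n : ℕ} where
    open ≡-Reasoning

    private
      D : List (Card n)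
      D = deck n

    quadSum : (f g h k : Card n → ℕ) → ℕ
    quadSum f g h k = ∑[ a ∈ D ] ∑[ b ∈ D ] ∑[ c ∈ D ] (f a * g b * h c * k (fourth a b c))

    ∑³-cong : ∀ {φ ψ : Card n → Card n → Card n → ℕ} → (∀ a b c → φ a b c ≡ ψ a b c) →
              ∑[ a ∈ D ] ∑[ b ∈ D ] ∑[ c ∈ D ] φ a b c ≡ ∑[ a ∈ D ] ∑[ b ∈ D ] ∑[ c ∈ D ] ψ a b c
    ∑³-cong φ≗ψ = ∑-cong D λ a → ∑-cong D λ b → ∑-cong D λ c → φ≗ψ a b c

    ∑³-+ : ∀ (φ ψ : Card n → Card n → Card n → ℕ) →
           ∑[ a ∈ D ] ∑[ b ∈ D ] ∑[ c ∈ D ] φ a b c + ∑[ a ∈ D ] ∑[ b ∈ D ] ∑[ c ∈ D ] ψ a b c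
             ≡ ∑[ a ∈ D ] ∑[ b ∈ D ] ∑[ c ∈ D ] (φ a b c + ψ a b c)
    ∑³-+ φ ψ = sym (trans (∑-cong D λ a → trans (∑-cong D λ b → ∑-+ D (φ a b) (ψ a b))
                                                    (∑-+ D _ _))
                            (∑-+ D _ _))

    ∑-fourth₁ : ∀ b c (k : Card n → ℕ) → ∑[ a ∈ D ] k (fourth a b c) ≡ ∑ D k
    ∑-fourth₁ b c k = trans (∑-cong D λ a → cong k (⊕-comm a (b ⊕ c))) (∑-deck-translate n (b ⊕ c) k)

    ∑-fourth₃ : ∀ a b (k : Card n → ℕ) → ∑[ c ∈ D ] k (fourth a b c) ≡ ∑ D k
    ∑-fourth₃ a b k = trans (∑-deck-translate n b (k ∘ (a ⊕_))) (∑-deck-translate n a k)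

    ∑-fourth₂ : ∀ a c (k : Card n → ℕ) → ∑[ b ∈ D ] k (fourth a b c) ≡ ∑ D k
    ∑-fourth₂ a c k = trans (∑-cong D λ b → cong (k ∘ (a ⊕_)) (⊕-comm b c)) (∑-fourth₃ a c k)

    ∑²-product : ∀ (f g : Card n → ℕ) K → ∑[ a ∈ D ] ∑[ b ∈ D ] (f a * g b * K) ≡ ∑ D f * ∑ D g * K
    ∑²-product f g K = begin
      ∑[ a ∈ D ] ∑[ b ∈ D ] (f a * g b * K)
        ≡⟨ ∑-cong D (λ a → trans (∑-*ʳ D K (λ b → f a * g b)) (cong (_* K) (∑-*ˡ D (f a) g))) ⟩
      ∑[ a ∈ D ] (f a * ∑ D g * K) ≡⟨ ∑-*ʳ D K (λ a → f a * ∑ D g) ⟩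
      ∑[ a ∈ D ] (f a * ∑ D g) * K ≡⟨ cong (_* K) (∑-*ʳ D (∑ D g) f) ⟩
      ∑ D f * ∑ D g * K            ∎

    quadSum-1₄ : ∀ f g h → quadSum f g h (λ _ → 1) ≡ ∑ D f * ∑ D g * ∑ D h
    quadSum-1₄ f g h = trans
      (∑-cong D λ a → ∑-cong D λ b →
         trans (∑-cong D λ c → *-identityʳ (f a * g b * h c)) (∑-*ˡ D (f a * g b) h))
      (∑²-product f g (∑ D h))

    quadSum-1₃ : ∀ f g k → quadSum f g (λ _ → 1) k ≡ ∑ D f * ∑ D g * ∑ D k
    quadSum-1₃ f g k = trans
      (∑-cong D λ a → ∑-cong D λ b →
         trans (∑-*ˡ D (f a * g b * 1) (k ∘ fourth a b))
                 (cong₂ _*_ (*-identityʳ (f a * g b)) (∑-fourth₃ a b k)))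
      (∑²-product f g (∑ D k))

    quadSum-1₂ : ∀ f h k → quadSum f (λ _ → 1) h k ≡ ∑ D f * ∑ D h * ∑ D k
    quadSum-1₂ f h k = trans
      (∑-cong D λ a → trans (∑-comm D D _) (∑-cong D λ c →
         trans (∑-*ˡ D (f a * 1 * h c) (λ b → k (fourth a b c)))
                 (cong₂ _*_ (cong (_* h c) (*-identityʳ (f a))) (∑-fourth₂ a c k))))
      (∑²-product f h (∑ D k))

    quadSum-1₁ : ∀ g h k → quadSum (λ _ → 1) g h k ≡ ∑ D g * ∑ D h * ∑ D k
    quadSum-1₁ g h k = trans (∑-comm D D _) (trans
      (∑-cong D λ b → trans (∑-comm D D _) (∑-cong D λ c →
         trans (∑-*ˡ D (1 * g b * h c) (λ a → k (fourth a b c)))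
                 (cong₂ _*_ (cong (_* h c) (*-identityˡ (g b))) (∑-fourth₁ b c k))))
      (∑²-product g h (∑ D k)))

    module _ {f f′ f″ : Card n → ℕ} (split : ∀ x → f x + f′ x ≡ f″ x) where

      quadSum-additive₁ : ∀ g h k → quadSum f g h k + quadSum f′ g h k ≡ quadSum f″ g h k
      quadSum-additive₁ g h k = trans (∑³-+ _ _) (∑³-cong λ a b c →
        trans (distrib (f a) (f′ a) (g b) (h c) (k (fourth a b c)))
                (cong (λ s → s * g b * h c * k (fourth a b c)) (split a)))
        where
        distrib : ∀ x x′ y z w → x * y * z * w + x′ * y * z * w ≡ (x + x′) * y * z * w
        distrib = solve-∀

      quadSum-additive₂ : ∀ e h k → quadSum e f h k + quadSum e f′ h k ≡ quadSum e f″ h k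
      quadSum-additive₂ e h k = trans (∑³-+ _ _) (∑³-cong λ a b c →
        trans (distrib (e a) (f b) (f′ b) (h c) (k (fourth a b c)))
                (cong (λ s → e a * s * h c * k (fourth a b c)) (split b)))
        where
        distrib : ∀ x y y′ z w → x * y * z * w + x * y′ * z * w ≡ x * (y + y′) * z * w
        distrib = solve-∀

      quadSum-additive₃ : ∀ e g k → quadSum e g f k + quadSum e g f′ k ≡ quadSum e g f″ k
      quadSum-additive₃ e g k = trans (∑³-+ _ _) (∑³-cong λ a b c →
        trans (distrib (e a) (g b) (f c) (f′ c) (k (fourth a b c)))
                (cong (λ s → e a * g b * s * k (fourth a b c)) (split c)))
        where
        distrib : ∀ x y z z′ w → x * y * z * w + x * y * z′ * w ≡ x * y * (z + z′) * w
        distrib = solve-∀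

      quadSum-additive₄ : ∀ e g h → quadSum e g h f + quadSum e g h f′ ≡ quadSum e g h f″
      quadSum-additive₄ e g h = trans (∑³-+ _ _) (∑³-cong λ a b c →
        trans (sym (*-distribˡ-+ (e a * g b * h c) (f (fourth a b c)) (f′ (fourth a b c))))
                (cong (e a * g b * h c *_) (split (fourth a b c))))

    quadSum-complement : ∀ (χ χ′ : Card n → ℕ) → (∀ x → χ x + χ′ x ≡ 1) →
      let m = ∑ D χ ; m′ = ∑ D χ′ in
      quadSum χ′ χ′ χ′ χ′ + m * m′ * m′ + m * m * m ≡ quadSum χ χ χ χ + m′ * m′ * m′ + m * m * m′
    quadSum-complement χ χ′ cover = begin
      U′ + m * m′ * m′ + m * m * m             ≡⟨ cong₂ (λ p q → U′ + p + q) (sym e₂) (sym e₄) ⟩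
      U′ + (X₁ + X₂) + (X₃ + U)                ≡⟨ regroup U′ X₁ X₂ X₃ U ⟩
      (U′ + X₁) + (X₂ + X₃) + U                ≡⟨ cong₂ (λ p q → p + q + U) e₁ e₃ ⟩
      m′ * m′ * m′ + m * m * m′ + U            ≡⟨ rotate (m′ * m′ * m′) (m * m * m′) U ⟩
      U + m′ * m′ * m′ + m * m * m′            ∎
      where
      m m′ U U′ X₁ X₂ X₃ : ℕ
      m = ∑ D χ
      m′ = ∑ D χ′
      U = quadSum χ χ χ χ
      U′ = quadSum χ′ χ′ χ′ χ′
      X₁ = quadSum χ χ′ χ′ χ′
      X₂ = quadSum χ χ χ′ χ′
      X₃ = quadSum χ χ χ χ′
      cover′ : ∀ x → χ′ x + χ x ≡ 1
      cover′ x = trans (+-comm (χ′ x) (χ x)) (cover x)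
      e₁ : U′ + X₁ ≡ m′ * m′ * m′
      e₁ = trans (quadSum-additive₁ {χ′} {χ} cover′ χ′ χ′ χ′) (quadSum-1₁ χ′ χ′ χ′)
      e₂ : X₁ + X₂ ≡ m * m′ * m′
      e₂ = trans (quadSum-additive₂ {χ′} {χ} cover′ χ χ′ χ′) (quadSum-1₂ χ χ′ χ′)
      e₃ : X₂ + X₃ ≡ m * m * m′
      e₃ = trans (quadSum-additive₃ {χ′} {χ} cover′ χ χ χ′) (quadSum-1₃ χ χ χ′)
      e₄ : X₃ + U ≡ m * m * m
      e₄ = trans (quadSum-additive₄ {χ′} {χ} cover′ χ χ χ) (quadSum-1₄ χ χ χ)
      regroup : ∀ u′ x₁ x₂ x₃ u → u′ + (x₁ + x₂) + (x₃ + u) ≡ (u′ + x₁) + (x₂ + x₃) + u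
      regroup = solve-∀
      rotate : ∀ p q u → p + q + u ≡ u + p + q
      rotate = solve-∀

module QuadCounts where
  open import Data.Nat using (_+_; _*_; _!)
  open import Data.Nat.Properties using (+-comm; +-assoc; +-cancelʳ-≡)
  open import Data.Nat.Tactic.RingSolver using (solve-∀)
  open import Relation.Nullary using (contradiction)
  open Sums
  open Cards
  open QuadSums

  module _ {n : ℕ} (S : CardSet n) where
    open ≡-Reasoning
    open Arrangements (_≟ᶜ_ {n})

    private
      D : List (Card n)
      D = deck n

    χ : Card n → ℕ
    χ = 𝟙 ∘ S

    quadIndicator : List (Card n) → ℕ
    quadIndicator q = 𝟙 (allIn S q ∧ isQuad q)

    distinctPairSum : ℕ
    distinctPairSum = ∑[ a ∈ D ] ∑[ b ∈ remove a D ] (χ a * χ b)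

    weight : Card n → Card n → Card n → ℕ
    weight a b c = χ a * χ b * χ c * χ (fourth a b c)

    distinctTripleSum : ℕ
    distinctTripleSum = ∑[ a ∈ D ] ∑[ b ∈ remove a D ] ∑[ c ∈ remove b (remove a D) ] weight a b c

    quadIndicator-invariant : PermutationInvariant quadIndicator
    quadIndicator-invariant p↭q =
      cong₂ (λ s z → 𝟙 (s ∧ isZero z)) (allIn-↭ S p↭q) (sumCards-↭ p↭q)

    quadIndicator-fourth : ∀ a b c →
      quadIndicator (a ∷ b ∷ c ∷ fourth a b c ∷ []) ≡ weight a b c
    quadIndicator-fourth a b c =
      trans (cong (λ t → 𝟙 (allIn S (a ∷ b ∷ c ∷ fourth a b c ∷ []) ∧ t)) (isQuad-fourth a b c))
              (𝟙-∧⁴ (S a) (S b) (S c) (S (fourth a b c)))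
      where
      𝟙-∧⁴ : ∀ p q r s → 𝟙 ((p ∧ (q ∧ (r ∧ (s ∧ true)))) ∧ true) ≡ 𝟙 p * 𝟙 q * 𝟙 r * 𝟙 s
      𝟙-∧⁴ false _     _     _     = refl
      𝟙-∧⁴ true  false _     _     = refl
      𝟙-∧⁴ true  true  false _     = refl
      𝟙-∧⁴ true  true  true  false = refl
      𝟙-∧⁴ true  true  true  true  = refl

    quadIndicator-≢fourth : ∀ a b c {d} → d ≢ fourth a b c → quadIndicator (a ∷ b ∷ c ∷ d ∷ []) ≡ 0
    quadIndicator-≢fourth a b c {d} d≢e with isQuad (a ∷ b ∷ c ∷ d ∷ []) in q
    ... | true  = contradiction (isQuad⇒≡fourth a b c q) d≢e
    ... | false = cong 𝟙 (Boolₚ.∧-zeroʳ _)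

    24*quadCount≡distinctTripleSum : 24 * quadCount S ≡ distinctTripleSum
    24*quadCount≡distinctTripleSum = begin
      24 * quadCount S
        ≡⟨ cong (24 *_) (length-filter≡∑𝟙 (λ q → allIn S q ∧ isQuad q) (choose 4 D)) ⟩
      4 ! * ∑ (choose 4 D) quadIndicator
        ≡⟨ sym (arrangementSum≡k!*∑choose 4 quadIndicator quadIndicator-invariant (deck-unique n)) ⟩
      arrangementSum 4 D quadIndicator
        ≡⟨ ∑-cong D (λ a → ∑-cong-∈ (remove a D) (λ b∈ → ∑-cong-∈ (remove _ (remove a D)) (λ c∈ →
             sumOutFourth a b∈ c∈))) ⟩
      distinctTripleSum ∎
      where
      sumOutFourth : ∀ a {b c} → b ∈ remove a D → c ∈ remove b (remove a D) →
        ∑[ d ∈ remove c (remove b (remove a D)) ] quadIndicator (a ∷ b ∷ c ∷ d ∷ []) ≡ weight a b c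
      sumOutFourth a {b} {c} b∈ c∈ =
        trans (∑-point _ unique e∈ (quadIndicator-≢fourth a b c)) (quadIndicator-fourth a b c)
        where
        unique : Unique (remove c (remove b (remove a D)))
        unique = remove-unique c (remove-unique b (remove-unique a (deck-unique n)))
        b≢a : b ≢ a
        b≢a = proj₂ (∈-remove⁻ {xs = D} b∈)
        c≢b : c ≢ b
        c≢b = proj₂ (∈-remove⁻ {xs = remove a D} c∈)
        c≢a : c ≢ a
        c≢a = proj₂ (∈-remove⁻ {xs = D} (proj₁ (∈-remove⁻ {xs = remove a D} c∈)))
        e∈ : fourth a b c ∈ remove c (remove b (remove a D))
        e∈ = ∈-remove⁺ (∈-remove⁺ (∈-remove⁺ (∈-deck _) (fourth≢₁ (≢-sym c≢b)))
                                  (fourth≢₂ (≢-sym c≢a)))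
                       (fourth≢₃ (≢-sym b≢a))

    private
      𝟙² : ∀ p → 𝟙 p * 𝟙 p ≡ 𝟙 p
      𝟙² false = refl
      𝟙² true  = refl

      weight-aab : ∀ a b → weight a a b ≡ χ a * χ b
      weight-aab a b = trans (cong (λ x → χ a * χ a * χ b * χ x) (fourth-aab a b)) (idem (S a) (S b))
        where
        idem : ∀ p q → 𝟙 p * 𝟙 p * 𝟙 q * 𝟙 q ≡ 𝟙 p * 𝟙 q
        idem false _     = refl
        idem true  false = refl
        idem true  true  = refl

      weight-aba : ∀ a b → weight a b a ≡ χ a * χ b
      weight-aba a b = trans (cong (λ x → χ a * χ b * χ a * χ x) (fourth-aba a b)) (idem (S a) (S b))
        where
        idem : ∀ p q → 𝟙 p * 𝟙 q * 𝟙 p * 𝟙 q ≡ 𝟙 p * 𝟙 q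
        idem false _     = refl
        idem true  false = refl
        idem true  true  = refl

      weight-abb : ∀ a b → weight a b b ≡ χ a * χ b
      weight-abb a b = trans (cong (λ x → χ a * χ b * χ b * χ x) (fourth-abb a b)) (idem (S a) (S b))
        where
        idem : ∀ p q → 𝟙 p * 𝟙 q * 𝟙 q * 𝟙 p ≡ 𝟙 p * 𝟙 q
        idem false _     = refl
        idem true  false = refl
        idem true  true  = refl

    distinctPairSum+m : distinctPairSum + ∑ D χ ≡ ∑ D χ * ∑ D χ
    distinctPairSum+m = begin
      distinctPairSum + ∑ D χ
        ≡⟨ +-comm distinctPairSum _ ⟩
      ∑ D χ + distinctPairSum
        ≡⟨ sym (∑-+ D χ _) ⟩
      ∑[ a ∈ D ] (χ a + ∑[ b ∈ remove a D ] (χ a * χ b))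
        ≡⟨ ∑-cong D (λ a → sym (trans (∑-remove _ (deck-unique n) (∈-deck a))
                                      (cong (_+ ∑[ b ∈ remove a D ] (χ a * χ b)) (𝟙² (S a))))) ⟩
      ∑[ a ∈ D ] ∑[ b ∈ D ] (χ a * χ b)
        ≡⟨ ∑-cong D (λ a → ∑-*ˡ D (χ a) χ) ⟩
      ∑[ a ∈ D ] (χ a * ∑ D χ)
        ≡⟨ ∑-*ʳ D (∑ D χ) χ ⟩
      ∑ D χ * ∑ D χ ∎

    quadSum≡diagonals : quadSum χ χ χ χ ≡ ∑ D χ * ∑ D χ + 2 * distinctPairSum + distinctTripleSum
    quadSum≡diagonals = begin
      ∑[ a ∈ D ] ∑[ b ∈ D ] ∑[ c ∈ D ] weight a b c
        ≡⟨ ∑-cong D row ⟩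
      ∑[ a ∈ D ] (χ a * ∑ D χ + (2 * P a + W a))
        ≡⟨ ∑-+ D _ _ ⟩
      ∑[ a ∈ D ] (χ a * ∑ D χ) + ∑[ a ∈ D ] (2 * P a + W a)
        ≡⟨ cong₂ _+_ (∑-*ʳ D (∑ D χ) χ) (trans (∑-+ D _ W) (cong (_+ distinctTripleSum) (∑-*ˡ D 2 P))) ⟩
      ∑ D χ * ∑ D χ + (2 * distinctPairSum + distinctTripleSum)
        ≡⟨ sym (+-assoc (∑ D χ * ∑ D χ) _ _) ⟩
      ∑ D χ * ∑ D χ + 2 * distinctPairSum + distinctTripleSum ∎
      where
      P W : Card n → ℕ
      P a = ∑[ b ∈ remove a D ] (χ a * χ b)
      W a = ∑[ b ∈ remove a D ] ∑[ c ∈ remove b (remove a D) ] weight a b c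
      column : ∀ {a b} → b ∈ remove a D →
               ∑[ c ∈ D ] weight a b c ≡ 2 * (χ a * χ b) + ∑[ c ∈ remove b (remove a D) ] weight a b c
      column {a} {b} b∈ = begin
        ∑[ c ∈ D ] weight a b c
          ≡⟨ ∑-remove _ (deck-unique n) (∈-deck a) ⟩
        weight a b a + ∑[ c ∈ remove a D ] weight a b c
          ≡⟨ cong (weight a b a +_) (∑-remove _ (remove-unique a (deck-unique n)) b∈) ⟩
        weight a b a + (weight a b b + ∑[ c ∈ remove b (remove a D) ] weight a b c)
          ≡⟨ cong₂ (λ x y → x + (y + ∑[ c ∈ remove b (remove a D) ] weight a b c))
                   (weight-aba a b) (weight-abb a b) ⟩
        χ a * χ b + (χ a * χ b + ∑[ c ∈ remove b (remove a D) ] weight a b c)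
          ≡⟨ double (χ a * χ b) _ ⟩
        2 * (χ a * χ b) + ∑[ c ∈ remove b (remove a D) ] weight a b c ∎
        where
        double : ∀ x r → x + (x + r) ≡ 2 * x + r
        double = solve-∀
      row : ∀ a → ∑[ b ∈ D ] ∑[ c ∈ D ] weight a b c ≡ χ a * ∑ D χ + (2 * P a + W a)
      row a = begin
        ∑[ b ∈ D ] ∑[ c ∈ D ] weight a b c
          ≡⟨ ∑-remove _ (deck-unique n) (∈-deck a) ⟩
        ∑[ c ∈ D ] weight a a c + ∑[ b ∈ remove a D ] ∑[ c ∈ D ] weight a b c
          ≡⟨ cong₂ _+_ (trans (∑-cong D (weight-aab a)) (∑-*ˡ D (χ a) χ))
                       (∑-cong-∈ (remove a D) column) ⟩
        χ a * ∑ D χ + ∑[ b ∈ remove a D ] (2 * (χ a * χ b) + ∑[ c ∈ remove b (remove a D) ] weight a b c)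
          ≡⟨ cong (χ a * ∑ D χ +_)
               (trans (∑-+ (remove a D) _ _) (cong (_+ W a) (∑-*ˡ (remove a D) 2 _))) ⟩
        χ a * ∑ D χ + (2 * P a + W a) ∎

    quadSum-diagonal : quadSum χ χ χ χ + 2 * ∑ D χ ≡ 3 * (∑ D χ * ∑ D χ) + 24 * quadCount S
    quadSum-diagonal = begin
      quadSum χ χ χ χ + 2 * m
        ≡⟨ cong (_+ 2 * m) quadSum≡diagonals ⟩
      m * m + 2 * distinctPairSum + distinctTripleSum + 2 * m
        ≡⟨ regroup (m * m) distinctPairSum distinctTripleSum m ⟩
      m * m + 2 * (distinctPairSum + m) + distinctTripleSum
        ≡⟨ cong₂ (λ x y → m * m + 2 * x + y) distinctPairSum+m (sym 24*quadCount≡distinctTripleSum) ⟩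
      m * m + 2 * (m * m) + 24 * quadCount S
        ≡⟨ triple (m * m) (24 * quadCount S) ⟩
      3 * (m * m) + 24 * quadCount S ∎
      where
      m : ℕ
      m = ∑ D χ
      regroup : ∀ x p w m → x + 2 * p + w + 2 * m ≡ x + 2 * (p + m) + w
      regroup = solve-∀
      triple : ∀ x y → x + 2 * x + y ≡ 3 * x + y
      triple = solve-∀

  offset : ℕ → ℕ → ℕ
  offset a b = a * (a * a + b * b) + 2 * a + 3 * (b * b)

  -- 24(s − t) = offset |S| |T| − offset |T| |S|, with both sides moved so that no subtraction occurs.
  quadCount-complement : ∀ {n} (S T : CardSet n) → (∀ x → T x ≡ not (S x)) →
    24 * quadCount S + offset (size T) (size S) ≡ 24 * quadCount T + offset (size S) (size T)
  quadCount-complement {n} S T T≡¬S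
    rewrite length-filter≡∑𝟙 S (deck n) | length-filter≡∑𝟙 T (deck n) =
    +-cancelʳ-≡ _ _ _ (begin
      24 * s + offset m′ m + ((U + 2 * m) + (3 * (m′ * m′) + 24 * t) + (U′ + m * m′ * m′ + m * m * m))
        ≡⟨ rearrange s t U U′ m m′ ⟩
      24 * t + offset m m′ + ((3 * (m * m) + 24 * s) + (U′ + 2 * m′) + (U + m′ * m′ * m′ + m * m * m′))
        ≡⟨ cong (24 * t + offset m m′ +_)
             (cong₂ _+_ (cong₂ _+_ (sym (quadSum-diagonal S)) (quadSum-diagonal T))
                        (sym (quadSum-complement (χ S) (χ T) cover))) ⟩
      24 * t + offset m m′ + ((U + 2 * m) + (3 * (m′ * m′) + 24 * t) + (U′ + m * m′ * m′ + m * m * m)) ∎)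
    where
    open ≡-Reasoning
    s t m m′ U U′ : ℕ
    s = quadCount S
    t = quadCount T
    m = ∑ (deck n) (χ S)
    m′ = ∑ (deck n) (χ T)
    U = quadSum (χ S) (χ S) (χ S) (χ S)
    U′ = quadSum (χ T) (χ T) (χ T) (χ T)
    cover : ∀ x → χ S x + χ T x ≡ 1
    cover x rewrite T≡¬S x with S x
    ... | true  = refl
    ... | false = refl
    rearrange : ∀ s t u u′ m m′ →
      24 * s + (m′ * (m′ * m′ + m * m) + 2 * m′ + 3 * (m * m))
        + ((u + 2 * m) + (3 * (m′ * m′) + 24 * t) + (u′ + m * m′ * m′ + m * m * m))
      ≡ 24 * t + (m * (m * m + m′ * m′) + 2 * m + 3 * (m′ * m′))
        + ((3 * (m * m) + 24 * s) + (u′ + 2 * m′) + (u + m′ * m′ * m′ + m * m * m′))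
    rearrange = solve-∀

module Binomials where
  open import Data.Nat using (_+_; _*_)
  open import Data.Nat.Combinatorics using (_C_; nCk+nC[k+1]≡[n+1]C[k+1]; nC1≡n)
  open import Data.Nat.Tactic.RingSolver using (solve-∀)
  open ≡-Reasoning

  2*nC2+n≡n*n : ∀ m → 2 * (m C 2) + m ≡ m * m
  2*nC2+n≡n*n zero    = refl
  2*nC2+n≡n*n (suc m) = begin
    2 * (suc m C 2) + suc m           ≡⟨ cong (λ c → 2 * c + suc m) (sym (nCk+nC[k+1]≡[n+1]C[k+1] m 1)) ⟩
    2 * (m C 1 + m C 2) + suc m       ≡⟨ cong (λ c → 2 * (c + m C 2) + suc m) (nC1≡n m) ⟩
    2 * (m + m C 2) + suc m           ≡⟨ step m (m C 2) ⟩
    2 * (m C 2) + m + (2 * m + 1)     ≡⟨ cong (_+ (2 * m + 1)) (2*nC2+n≡n*n m) ⟩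
    m * m + (2 * m + 1)               ≡⟨ square m ⟩
    suc m * suc m                     ∎
    where
    step : ∀ m c → 2 * (m + c) + suc m ≡ 2 * c + m + (2 * m + 1)
    step = solve-∀
    square : ∀ m → m * m + (2 * m + 1) ≡ suc m * suc m
    square = solve-∀

  6*nC3+3*n*n≡n*n*n+2*n : ∀ m → 6 * (m C 3) + 3 * m * m ≡ m * m * m + 2 * m
  6*nC3+3*n*n≡n*n*n+2*n zero    = refl
  6*nC3+3*n*n≡n*n*n+2*n (suc m) = begin
    6 * (suc m C 3) + 3 * suc m * suc m
      ≡⟨ cong (λ c → 6 * c + 3 * suc m * suc m) (sym (nCk+nC[k+1]≡[n+1]C[k+1] m 2)) ⟩
    6 * (m C 2 + m C 3) + 3 * suc m * suc m
      ≡⟨ step m (m C 2) (m C 3) ⟩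
    (6 * (m C 3) + 3 * m * m) + 3 * (2 * (m C 2) + m) + 3 * m + 3
      ≡⟨ cong₂ (λ x y → x + 3 * y + 3 * m + 3) (6*nC3+3*n*n≡n*n*n+2*n m) (2*nC2+n≡n*n m) ⟩
    m * m * m + 2 * m + 3 * (m * m) + 3 * m + 3
      ≡⟨ cube m ⟩
    suc m * suc m * suc m + 2 * suc m ∎
    where
    step : ∀ m c₂ c₃ →
      6 * (c₂ + c₃) + 3 * suc m * suc m ≡ (6 * c₃ + 3 * m * m) + 3 * (2 * c₂ + m) + 3 * m + 3
    step = solve-∀
    cube : ∀ m → m * m * m + 2 * m + 3 * (m * m) + 3 * m + 3 ≡ suc m * suc m * suc m + 2 * suc m
    cube = solve-∀

open QuadCounts
open Binomials

open import Data.Nat as ℕ using ()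
open import Data.Nat.Combinatorics using (_C_)
open import Data.Nat.Coprimality using (1-coprimeTo) renaming (sym to coprime-sym)
open import Data.Integer as ℤ using (+_)
import Data.Integer.Properties as ℤₚ
open import Data.Rational using (ℚ; mkℚ; _/_; _+_; _-_; _*_; 1ℚ)
open import Data.Rational.Properties using (normalize-coprime; *-identityˡ)
open import Data.Rational.Solver using (module +-*-Solver)
open import Data.Sum using (_⊎_; inj₂)
open +-*-Solver using (Polynomial; solve; _:=_; _:+_; _:-_; _:*_; con)

ℕ→ℚ≡mkℚ : ∀ a → ℕ→ℚ a ≡ mkℚ (+ a) 0 (coprime-sym (1-coprimeTo a))
ℕ→ℚ≡mkℚ a = normalize-coprime (coprime-sym (1-coprimeTo a))

ℕ→ℚ-+ : ∀ a b → ℕ→ℚ (a ℕ.+ b) ≡ ℕ→ℚ a + ℕ→ℚ b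
ℕ→ℚ-+ a b = trans (cong (_/ 1) (sym (cong₂ ℤ._+_ (ℤₚ.*-identityʳ (+ a)) (ℤₚ.*-identityʳ (+ b)))))
                  (sym (cong₂ _+_ (ℕ→ℚ≡mkℚ a) (ℕ→ℚ≡mkℚ b)))

ℕ→ℚ-* : ∀ a b → ℕ→ℚ (a ℕ.* b) ≡ ℕ→ℚ a * ℕ→ℚ b
ℕ→ℚ-* a b = trans (cong (_/ 1) (ℤₚ.pos-* a b)) (sym (cong₂ _*_ (ℕ→ℚ≡mkℚ a) (ℕ→ℚ≡mkℚ b)))

-- Identities are carried from ℕ to ℚ along an explicit syntax tree: leaving the shape of a
-- ℚ-term to unification makes Agda normalise the gcd computations inside _+_ and _*_.
infixl 6 _⊞_
infixl 7 _⊠_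

data Expr : Set where
  ‵_      : ℕ → Expr
  _⊞_ _⊠_ : Expr → Expr → Expr

⟦_⟧ℕ : Expr → ℕ
⟦ ‵ a   ⟧ℕ = a
⟦ e ⊞ f ⟧ℕ = ⟦ e ⟧ℕ ℕ.+ ⟦ f ⟧ℕ
⟦ e ⊠ f ⟧ℕ = ⟦ e ⟧ℕ ℕ.* ⟦ f ⟧ℕ

⟦_⟧ℚ : Expr → ℚ
⟦ ‵ a   ⟧ℚ = ℕ→ℚ a
⟦ e ⊞ f ⟧ℚ = ⟦ e ⟧ℚ + ⟦ f ⟧ℚ
⟦ e ⊠ f ⟧ℚ = ⟦ e ⟧ℚ * ⟦ f ⟧ℚ

ℕ→ℚ-⟦⟧ : ∀ e → ℕ→ℚ ⟦ e ⟧ℕ ≡ ⟦ e ⟧ℚ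
ℕ→ℚ-⟦⟧ (‵ a)   = refl
ℕ→ℚ-⟦⟧ (e ⊞ f) = trans (ℕ→ℚ-+ ⟦ e ⟧ℕ ⟦ f ⟧ℕ) (cong₂ _+_ (ℕ→ℚ-⟦⟧ e) (ℕ→ℚ-⟦⟧ f))
ℕ→ℚ-⟦⟧ (e ⊠ f) = trans (ℕ→ℚ-* ⟦ e ⟧ℕ ⟦ f ⟧ℕ) (cong₂ _*_ (ℕ→ℚ-⟦⟧ e) (ℕ→ℚ-⟦⟧ f))

⟦⟧ℕ≡⇒⟦⟧ℚ≡ : ∀ e f → ⟦ e ⟧ℕ ≡ ⟦ f ⟧ℕ → ⟦ e ⟧ℚ ≡ ⟦ f ⟧ℚ
⟦⟧ℕ≡⇒⟦⟧ℚ≡ e f eq = trans (sym (ℕ→ℚ-⟦⟧ e)) (trans (cong ℕ→ℚ eq) (ℕ→ℚ-⟦⟧ f))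

solve-scaled : ∀ k k⁻¹ a c d → k⁻¹ * ℕ→ℚ k ≡ 1ℚ → k ℕ.* a ℕ.+ ⟦ c ⟧ℕ ≡ ⟦ d ⟧ℕ →
               ℕ→ℚ a ≡ k⁻¹ * (⟦ d ⟧ℚ - ⟦ c ⟧ℚ)
solve-scaled k k⁻¹ a c d inv eq = begin
  ℕ→ℚ a
    ≡⟨ sym (*-identityˡ (ℕ→ℚ a)) ⟩
  1ℚ * ℕ→ℚ a
    ≡⟨ cong (_* ℕ→ℚ a) (sym inv) ⟩
  k⁻¹ * ℕ→ℚ k * ℕ→ℚ a
    ≡⟨ solve 4 (λ k k⁻¹ a c → k⁻¹ :* k :* a := k⁻¹ :* ((k :* a :+ c) :- c))
             refl (ℕ→ℚ k) k⁻¹ (ℕ→ℚ a) ⟦ c ⟧ℚ ⟩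
  k⁻¹ * ((ℕ→ℚ k * ℕ→ℚ a + ⟦ c ⟧ℚ) - ⟦ c ⟧ℚ)
    ≡⟨ cong (λ x → k⁻¹ * (x - ⟦ c ⟧ℚ)) (⟦⟧ℕ≡⇒⟦⟧ℚ≡ (‵ k ⊠ ‵ a ⊞ c) d eq) ⟩
  k⁻¹ * (⟦ d ⟧ℚ - ⟦ c ⟧ℚ) ∎
  where open ≡-Reasoning

ℕ→ℚ-C2 : ∀ m → ℕ→ℚ (m C 2) ≡ (+ 1 / 2) * (ℕ→ℚ m * ℕ→ℚ m - ℕ→ℚ m)
ℕ→ℚ-C2 m = solve-scaled 2 (+ 1 / 2) (m C 2) (‵ m) (‵ m ⊠ ‵ m) refl (2*nC2+n≡n*n m)

ℕ→ℚ-C3 : ∀ m → ℕ→ℚ (m C 3)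
  ≡ (+ 1 / 6) * (ℕ→ℚ m * ℕ→ℚ m * ℕ→ℚ m + ℕ→ℚ 2 * ℕ→ℚ m - ℕ→ℚ 3 * ℕ→ℚ m * ℕ→ℚ m)
ℕ→ℚ-C3 m = solve-scaled 6 (+ 1 / 6) (m C 3) (‵ 3 ⊠ ‵ m ⊠ ‵ m) (‵ m ⊠ ‵ m ⊠ ‵ m ⊞ ‵ 2 ⊠ ‵ m) refl
                        (6*nC3+3*n*n≡n*n*n+2*n m)

offsetExpr : ℕ → ℕ → Expr
offsetExpr a b = ‵ a ⊠ (‵ a ⊠ ‵ a ⊞ ‵ b ⊠ ‵ b) ⊞ ‵ 2 ⊠ ‵ a ⊞ ‵ 3 ⊠ (‵ b ⊠ ‵ b)

difference-formula : ∀ s t m m′ → 24 ℕ.* s ℕ.+ offset m′ m ≡ 24 ℕ.* t ℕ.+ offset m m′ →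
  ℕ→ℚ s - ℕ→ℚ t
    ≡ ((+ 1 / 24) * (ℕ→ℚ m - ℕ→ℚ m′))
      * (ℕ→ℚ m * ℕ→ℚ m + ℕ→ℚ m′ * ℕ→ℚ m′ - ℕ→ℚ 3 * ℕ→ℚ m - ℕ→ℚ 3 * ℕ→ℚ m′ + ℕ→ℚ 2)
difference-formula s t m m′ eq = trans
  (cong (_- ℕ→ℚ t)
    (solve-scaled 24 (+ 1 / 24) s (offsetExpr m′ m) (‵ 24 ⊠ ‵ t ⊞ offsetExpr m m′) refl eq))
  (solve 3 (λ t x y →
      con (+ 1 / 24) :* ((con (ℕ→ℚ 24) :* t :+ offsetPoly x y) :- offsetPoly y x) :- t
        := (con (+ 1 / 24) :* (x :- y))
           :* (x :* x :+ y :* y :- con (ℕ→ℚ 3) :* x :- con (ℕ→ℚ 3) :* y :+ con (ℕ→ℚ 2)))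
    refl (ℕ→ℚ t) (ℕ→ℚ m) (ℕ→ℚ m′))
  where
  offsetPoly : Polynomial 3 → Polynomial 3 → Polynomial 3
  offsetPoly a b = a :* (a :* a :+ b :* b) :+ con (ℕ→ℚ 2) :* a :+ con (ℕ→ℚ 3) :* (b :* b)

binomial-form : ∀ m m′ →
  ((+ 1 / 24) * (ℕ→ℚ m - ℕ→ℚ m′))
    * (ℕ→ℚ m * ℕ→ℚ m + ℕ→ℚ m′ * ℕ→ℚ m′ - ℕ→ℚ 3 * ℕ→ℚ m - ℕ→ℚ 3 * ℕ→ℚ m′ + ℕ→ℚ 2)
  ≡ (+ 1 / 4) * (ℕ→ℚ (m C 3) - ℕ→ℚ (m′ C 3))
    + (+ 1 / 12) * (ℕ→ℚ m * ℕ→ℚ (m′ C 2) - ℕ→ℚ m′ * ℕ→ℚ (m C 2))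
binomial-form m m′ = trans
  (solve 2 (λ x y →
      (con (+ 1 / 24) :* (x :- y))
        :* (x :* x :+ y :* y :- con (ℕ→ℚ 3) :* x :- con (ℕ→ℚ 3) :* y :+ con (ℕ→ℚ 2))
      := con (+ 1 / 4) :* (c₃ x :- c₃ y) :+ con (+ 1 / 12) :* (x :* c₂ y :- y :* c₂ x))
    refl (ℕ→ℚ m) (ℕ→ℚ m′))
  (sym (cong₂ (λ u v → (+ 1 / 4) * u + (+ 1 / 12) * v)
              (cong₂ _-_ (ℕ→ℚ-C3 m) (ℕ→ℚ-C3 m′))
              (cong₂ (λ p q → ℕ→ℚ m * p - ℕ→ℚ m′ * q) (ℕ→ℚ-C2 m′) (ℕ→ℚ-C2 m))))
  where
  c₂ c₃ : Polynomial 2 → Polynomial 2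
  c₂ x = con (+ 1 / 2) :* (x :* x :- x)
  c₃ x = con (+ 1 / 6) :* (x :* x :* x :+ con (ℕ→ℚ 2) :* x :- con (ℕ→ℚ 3) :* x :* x)

quadCount-difference : ∀ {n} (S T : CardSet n) → (∀ x → T x ≡ not (S x)) →
  ℕ→ℚ (quadCount S) - ℕ→ℚ (quadCount T)
    ≡ ((+ 1 / 24) * (ℕ→ℚ (size S) - ℕ→ℚ (size T)))
      * (ℕ→ℚ (size S) * ℕ→ℚ (size S) + ℕ→ℚ (size T) * ℕ→ℚ (size T)
         - ℕ→ℚ 3 * ℕ→ℚ (size S) - ℕ→ℚ 3 * ℕ→ℚ (size T) + ℕ→ℚ 2)
quadCount-difference S T T≡¬S =
  difference-formula (quadCount S) (quadCount T) (size S) (size T) (quadCount-complement S T T≡¬S)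

complementary : ∀ {n} {S T : CardSet n} →
  (∀ x → S x ≡ true → T x ≡ false) → (∀ x → S x ≡ true ⊎ T x ≡ true) → ∀ x → T x ≡ not (S x)
complementary {S = S} disjoint covering x with S x in Sx | covering x
... | true  | _      = disjoint x Sx
... | false | inj₂ t = t

mainTheorem4 : (n : ℕ) (S T : CardSet n) →
    (∀ x → S x ≡ true → T x ≡ false) →
    (∀ x → S x ≡ true ⊎ T x ≡ true) →
    (ℕ→ℚ (quadCount S) - ℕ→ℚ (quadCount T)
       ≡ (+ 1 / 4) * (ℕ→ℚ (size S C 3) - ℕ→ℚ (size T C 3))
         + (+ 1 / 12) * (ℕ→ℚ (size S) * ℕ→ℚ (size T C 2) - ℕ→ℚ (size T) * ℕ→ℚ (size S C 2)))
    × (ℕ→ℚ (quadCount S) - ℕ→ℚ (quadCount T)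
       ≡ ((+ 1 / 24) * (ℕ→ℚ (size S) - ℕ→ℚ (size T)))
         * (ℕ→ℚ (size S) * ℕ→ℚ (size S) + ℕ→ℚ (size T) * ℕ→ℚ (size T)
            - ℕ→ℚ 3 * ℕ→ℚ (size S) - ℕ→ℚ 3 * ℕ→ℚ (size T) + ℕ→ℚ 2))
mainTheorem4 n S T disjoint covering =
  trans (quadCount-difference S T T≡¬S) (binomial-form (size S) (size T)) ,
  quadCount-difference S T T≡¬S
  where
  T≡¬S : ∀ x → T x ≡ not (S x)
  T≡¬S = complementary disjoint covering
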